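{- Let $\mathfrak K=(K,\bigsqcup,\odot,{}^*,{\sim},e)$ be a $\mathscr T$-based orthomodular dynamic algebra. Then for each $k\in K$ there exists a unique set $S\subseteq\mathscr T(K)$ such that $k=\bigsqcup S$.
   Context: A unital involutive quantale $(K,\bigsqcup,\odot,{}^*,e)$: complete join-semilattice (binary join $\sqcup$), associative $\odot$ distributing over arbitrary joins on both sides, two-sided unit $e$, involution with $x^{**}=x$, $(x\odot y)^*=y^*\odot x^*$, $(\bigsqcup x_i)^*=\bigsqcup x_i^*$. An involutive generalized dynamic algebra (IDA) is $(K,\bigsqcup,\odot,{}^*,{\sim},e)$ with such a quantale and ${\sim}:K\to K$ satisfying for all $x,y$ and families $(x_i)$: ${\sim}(x\odot{\sim}{\sim}y)={\sim}(x\odot y)$; ${\sim}(\bigsqcup_i{\sim}{\sim}x_i)={\sim}(\bigsqcup_ix_i)$; $({\sim}x)^*={\sim}x$; ${\sim}{\sim}({\sim}{\sim}x\odot y)={\sim}({\sim}x\sqcup{\sim}({\sim}x\sqcup y))$. Notation: $\widetilde K=\{{\sim}k\}$; $\bigvee W={\sim}{\sim}\bigsqcup W$; $k\preceq l$ iff $\bigvee\{k,l\}=l$; $w^\perp={\sim}w$; $k\bullet v={\sim}{\sim}(k\odot v)$; $k\equiv l$ iff $k\bullet w=l\bullet w$ for all $w\in\widetilde K$. IDA morphisms preserve arbitrary joins, $\odot$, unit, ${}^*$, ${\sim}$. Semi-Foulis: $(\widetilde K,\preceq,{}^\perp)$ is a complete orthomodular lattice (OML). For a complete OML $\mathcal M$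 with Sasaki projections $\pi_m(x)=m\wedge(m^\perp\vee x)$, $\mathbf{Lin}(\mathcal M)$ is the set of maps $f:M\to M$ admitting $f^*$ with $f(x)\le y^\perp\iff x\le f^*(y)^\perp$, with pointwise joins, $\odot=\circ$, involution $f^*$, unit $\mathrm{id}_M$ and ${\sim}f=\pi_{f(1)^\perp}$; it is an IDA with test set $\{\pi_m\}$. For an involutive submonoid $L\subseteq\mathbf{Lin}(\mathcal M)$ containing all $\pi_m$, $\mathscr P(L)$ is the IDA of subsets of $L$ with union, $A\odot B=\{a\circ b\}$, $A^*=\{a^*\}$, ${\sim}A=\{\pi_{(\bigvee_{a\in A}a(1))^\perp}\}$, unit $\{\mathrm{id}_M\}$. $\mathbb{IM}$ is the category of involutive monoids and maps preserving product, unit and involution. Fix a functor $\mathscr T$ from IDAs to $\mathbb{IM}$ such that: (T1) $\widetilde K\subseteq\mathscr T(K)\subseteq K$ and $\mathscr T(\mathfrak K)=(\mathscr T(K),\odot,{}^*,e)$ is an involutive submonoid of $K$; (T2) for every semi-Foulis $\mathfrak K$ with $s=t\iff s\equiv t$ for $s,t\in\mathscr T(K)$, the map $\nu_{\mathfrak K}(k)=k\bullet(-)$ is an isomorphism in $\mathbb{IM}$ from $\mathscr T(\mathfrak K)$ onto $\mathscr T(\mathbf{Lin}(\widetilde K,\preceq,{}^\perp))$; (T3) for every complete OML $\mathcal M$, $f\mapsto\{f\}$ is an isomorphism in $\mathbb{IM}$ from $\mathscr T(\mathbf{Lin}(\mathcal M))$ onto $\mathscr T(\mathscr P(\mathscr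 T(\mathbf{Lin}(\mathcal M))))$; (T4) $\mathscr T(f)$ is the restriction of $f$. A $\mathscr T$-based orthomodular dynamic algebra is an IDA with: (TODA1) $(\widetilde K,\preceq,{}^\perp)$ is a complete OML; (TODA2) any $A$ with $\mathscr T(K)\subseteq A\subseteq K$ closed under $\odot$, ${}^*$ and arbitrary joins equals $K$; (TODA3) for $S,T\subseteq\mathscr T(K)$, $\bigsqcup S=\bigsqcup T$ iff $S=T$; (TODA4) for $s,t\in\mathscr T(K)$, $s=t$ iff $s\equiv t$. -}

module Defs where

open import Level using (Level; _⊔_; suc; Lift; lift; Setω)
open import Data.Bool using (Bool; true; false)
open import Data.Product using (Σ; _×_; _,_; proj₁; ∃)
open import Relation.Binary.PropositionalEquality using (_≡_)
open import Relation.Binary.Structures using (IsPartialOrder)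
open import Relation.Unary using (Pred; _⊆_; _≐_)

-- Complete orthomodular lattice structure on a subset C of a type X,
-- with order _≤_ and orthocomplement _ᶜ (both given on all of X,
-- but only required to behave on C).

record IsCompleteOML {ℓ} {X : Set ℓ} (C : Pred X ℓ)
                     (_≤_ : X → X → Set ℓ) (_ᶜ : X → X) : Set (suc ℓ) where
  field
    ≤-refl    : ∀ {x} → C x → x ≤ x
    ≤-antisym : ∀ {x y} → C x → C y → x ≤ y → y ≤ x → x ≡ y
    ≤-trans   : ∀ {x y z} → C x → C y → C z → x ≤ y → y ≤ z → x ≤ z
    sup : ∀ {I : Set ℓ} (f : I → X) → (∀ i → C (f i)) →
          Σ X λ s → C s × (∀ i → f i ≤ s) × (∀ u → C u → (∀ i → f i ≤ u) → s ≤ u)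
    inf : ∀ {I : Set ℓ} (f : I → X) → (∀ i → C (f i)) →
          Σ X λ s → C s × (∀ i → s ≤ f i) × (∀ u → C u → (∀ i → u ≤ f i) → u ≤ s)
    _∨_ : X → X → X
    _∧_ : X → X → X
    ∨-closed : ∀ {x y} → C x → C y → C (x ∨ y)
    ∧-closed : ∀ {x y} → C x → C y → C (x ∧ y)
    ∨-ubˡ  : ∀ {x y} → C x → C y → x ≤ (x ∨ y)
    ∨-ubʳ  : ∀ {x y} → C x → C y → y ≤ (x ∨ y)
    ∨-least : ∀ {x y u} → C x → C y → C u → x ≤ u → y ≤ u → (x ∨ y) ≤ u
    ∧-lbˡ  : ∀ {x y} → C x → C y → (x ∧ y) ≤ x
    ∧-lbʳ  : ∀ {x y} → C x → C y → (x ∧ y) ≤ y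
    ∧-greatest : ∀ {x y u} → C x → C y → C u → u ≤ x → u ≤ y → u ≤ (x ∧ y)
    ᶜ-closed  : ∀ {x} → C x → C (x ᶜ)
    ᶜ-invol   : ∀ {x} → C x → (x ᶜ) ᶜ ≡ x
    ᶜ-antitone : ∀ {x y} → C x → C y → x ≤ y → (y ᶜ) ≤ (x ᶜ)
    ᶜ-compl   : ∀ {x u} → C x → C u → (x ∧ (x ᶜ)) ≤ u
    orthomodular : ∀ {x y} → C x → C y → x ≤ y → y ≡ x ∨ (y ∧ (x ᶜ))

-- Involutive generalized dynamic algebras (IDAs).
-- The complete join-semilattice is given by a partial order with
-- joins ⨆ of arbitrary families indexed by types of level ℓ.

record IDA (ℓ : Level) : Set (suc ℓ) where
  infixl 7 _⊙_
  field
    Carrier : Set ℓ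
    _≤_     : Carrier → Carrier → Set ℓ
    ≤-isPartialOrder : IsPartialOrder _≡_ _≤_
    ⨆       : {I : Set ℓ} → (I → Carrier) → Carrier
    ⨆-ub    : ∀ {I : Set ℓ} (f : I → Carrier) (i : I) → f i ≤ ⨆ f
    ⨆-least : ∀ {I : Set ℓ} (f : I → Carrier) (u : Carrier) →
              (∀ i → f i ≤ u) → ⨆ f ≤ u
    _⊙_     : Carrier → Carrier → Carrier
    _*      : Carrier → Carrier
    ∼       : Carrier → Carrier
    e       : Carrier
    ⊙-assoc : ∀ x y z → (x ⊙ y) ⊙ z ≡ x ⊙ (y ⊙ z)
    ⊙-identityˡ : ∀ x → e ⊙ x ≡ x
    ⊙-identityʳ : ∀ x → x ⊙ e ≡ x
    ⊙-distribˡ : ∀ {I : Set ℓ} (x : Carrier) (f : I → Carrier) →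
                 x ⊙ ⨆ f ≡ ⨆ (λ i → x ⊙ f i)
    ⊙-distribʳ : ∀ {I : Set ℓ} (x : Carrier) (f : I → Carrier) →
                 ⨆ f ⊙ x ≡ ⨆ (λ i → f i ⊙ x)
    *-invol : ∀ x → (x *) * ≡ x
    *-⊙     : ∀ x y → (x ⊙ y) * ≡ (y *) ⊙ (x *)
    *-⨆     : ∀ {I : Set ℓ} (f : I → Carrier) → (⨆ f) * ≡ ⨆ (λ i → f i *)

  _⊔ₖ_ : Carrier → Carrier → Carrier
  x ⊔ₖ y = ⨆ {Lift ℓ Bool} (λ { (lift true) → x ; (lift false) → y })

  field
    ∼-⊙   : ∀ x y → ∼ (x ⊙ ∼ (∼ y)) ≡ ∼ (x ⊙ y)
    ∼-⨆   : ∀ {I : Set ℓ} (f : I → Carrier) → ∼ (⨆ (λ i → ∼ (∼ (f i)))) ≡ ∼ (⨆ f)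
    ∼-*   : ∀ x → (∼ x) * ≡ ∼ x
    ∼-mix : ∀ x y → ∼ (∼ (∼ (∼ x) ⊙ y)) ≡ ∼ (∼ x ⊔ₖ ∼ (∼ x ⊔ₖ y))

  ⨆ₛ : Pred Carrier ℓ → Carrier
  ⨆ₛ S = ⨆ {Σ Carrier S} proj₁

  Tilde : Pred Carrier ℓ
  Tilde w = Σ Carrier λ k → w ≡ ∼ k

  -- ⋁ W = ∼∼ ⨆ W  (binary case) ; k ⪯ l iff ⋁{k,l} = l
  _⪯_ : Carrier → Carrier → Set ℓ
  k ⪯ l = ∼ (∼ (k ⊔ₖ l)) ≡ l

  _⊥ : Carrier → Carrier
  w ⊥ = ∼ w

  _•_ : Carrier → Carrier → Carrier
  k • v = ∼ (∼ (k ⊙ v))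

  _≋_ : Carrier → Carrier → Set ℓ
  k ≋ l = ∀ w → Tilde w → k • w ≡ l • w

module _ {ℓ} (𝔎 : IDA ℓ) where
  open IDA 𝔎

  record T1 (TK : Pred Carrier ℓ) : Set ℓ where
    field
      tilde⊆ : Tilde ⊆ TK
      e∈     : TK e
      ⊙-closed : ∀ {x y} → TK x → TK y → TK (x ⊙ y)
      *-closed : ∀ {x} → TK x → TK (x *)

  TODA1 : Set (suc ℓ)
  TODA1 = IsCompleteOML Tilde _⪯_ _⊥

  TODA2 : Pred Carrier ℓ → Setω
  TODA2 TK = ∀ {a} (A : Pred Carrier a) → TK ⊆ A →
             (∀ {x y} → A x → A y → A (x ⊙ y)) →
             (∀ {x} → A x → A (x *)) →
             (∀ {I : Set ℓ} (f : I → Carrier) → (∀ i → A (f i)) → A (⨆ f)) →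
             ∀ k → A k

  TODA3 : Pred Carrier ℓ → Set (suc ℓ)
  TODA3 TK = ∀ (S T : Pred Carrier ℓ) → S ⊆ TK → T ⊆ TK →
             (⨆ₛ S ≡ ⨆ₛ T → S ≐ T) × (S ≐ T → ⨆ₛ S ≡ ⨆ₛ T)

  TODA4 : Pred Carrier ℓ → Set ℓ
  TODA4 TK = ∀ {s t} → TK s → TK t → (s ≡ t → s ≋ t) × (s ≋ t → s ≡ t)

-- Existence: the elements that are joins of subsets of 𝒯(K) contain 𝒯(K)
-- (t is the join of {t}) and are closed under ⊙, * and arbitrary joins,
-- because ⊙ and * distribute over joins and 𝒯(K) is closed under ⊙ and *;
-- by (TODA2) they exhaust K.  Uniqueness is exactly (TODA3).
module Submission where

open import Defs
open import Data.Product using (Σ; _×_; _,_; proj₁; proj₂; uncurry)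
open import Relation.Binary.PropositionalEquality using (_≡_; refl; sym; trans; module ≡-Reasoning)
open import Relation.Binary.Structures using (IsPartialOrder)
open import Relation.Unary using (Pred; _⊆_; _≐_; ⋃)
open import Level using (suc)

module Joins {ℓ} (𝔎 : IDA ℓ) where
  open IDA 𝔎
  open IsPartialOrder ≤-isPartialOrder using (antisym; reflexive) renaming (trans to ≤-trans)
  open ≡-Reasoning

  Image : {I : Set ℓ} → (I → Carrier) → Pred Carrier ℓ
  Image {I} f z = Σ I λ i → z ≡ f i

  Image⊆ : ∀ {I : Set ℓ} {P : Pred Carrier ℓ} {f : I → Carrier} →
           (∀ i → P (f i)) → Image f ⊆ P
  Image⊆ Pf (i , refl) = Pf i

  ⨆-cong : ∀ {I : Set ℓ} {f g : I → Carrier} → (∀ i → f i ≡ g i) → ⨆ f ≡ ⨆ g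
  ⨆-cong f≗g = antisym (⨆-least _ _ λ i → ≤-trans (reflexive (f≗g i)) (⨆-ub _ i))
                       (⨆-least _ _ λ i → ≤-trans (reflexive (sym (f≗g i))) (⨆-ub _ i))

  ⨆-⨆ : ∀ {I : Set ℓ} {J : I → Set ℓ} (g : (i : I) → J i → Carrier) →
        ⨆ (λ i → ⨆ (g i)) ≡ ⨆ {Σ I J} (uncurry g)
  ⨆-⨆ g = antisym (⨆-least _ _ λ i → ⨆-least _ _ λ j → ⨆-ub (uncurry g) (i , j))
                  (⨆-least _ _ λ { (i , j) → ≤-trans (⨆-ub (g i) j) (⨆-ub _ i) })

  ⨆≡⨆ₛ-Image : ∀ {I : Set ℓ} (f : I → Carrier) → ⨆ f ≡ ⨆ₛ (Image f)
  ⨆≡⨆ₛ-Image f = antisym (⨆-least _ _ λ i → ⨆-ub proj₁ (f i , i , refl))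
                         (⨆-least _ _ λ { (_ , i , refl) → ⨆-ub f i })

  ⨆ₛ-singleton : ∀ t → t ≡ ⨆ₛ (_≡ t)
  ⨆ₛ-singleton t = antisym (⨆-ub proj₁ (t , refl))
                           (⨆-least proj₁ t λ { (_ , x≡t) → reflexive x≡t })

  _⊙ₛ_ : Pred Carrier ℓ → Pred Carrier ℓ → Pred Carrier ℓ
  S ⊙ₛ T = Image {Σ Carrier S × Σ Carrier T} (uncurry λ s t → proj₁ s ⊙ proj₁ t)

  ⨆ₛ-⊙ : ∀ S T → ⨆ₛ S ⊙ ⨆ₛ T ≡ ⨆ₛ (S ⊙ₛ T)
  ⨆ₛ-⊙ S T = begin
    ⨆ₛ S ⊙ ⨆ₛ T                            ≡⟨ ⊙-distribʳ (⨆ₛ T) proj₁ ⟩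
    ⨆ (λ s → proj₁ s ⊙ ⨆ₛ T)               ≡⟨ ⨆-cong (λ s → ⊙-distribˡ (proj₁ s) proj₁) ⟩
    ⨆ (λ s → ⨆ (λ t → proj₁ s ⊙ proj₁ t))  ≡⟨ ⨆-⨆ (λ s t → proj₁ s ⊙ proj₁ t) ⟩
    ⨆ (uncurry λ s t → proj₁ s ⊙ proj₁ t)  ≡⟨ ⨆≡⨆ₛ-Image _ ⟩
    ⨆ₛ (S ⊙ₛ T)                            ∎

  _*ₛ : Pred Carrier ℓ → Pred Carrier ℓ
  S *ₛ = Image {Σ Carrier S} λ s → proj₁ s *

  ⨆ₛ-* : ∀ S → (⨆ₛ S) * ≡ ⨆ₛ (S *ₛ)
  ⨆ₛ-* S = trans (*-⨆ proj₁) (⨆≡⨆ₛ-Image _)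

  ⨆-⨆ₛ≡⨆ₛ-⋃ : ∀ {I : Set ℓ} (S : I → Pred Carrier ℓ) → ⨆ (λ i → ⨆ₛ (S i)) ≡ ⨆ₛ (⋃ I S)
  ⨆-⨆ₛ≡⨆ₛ-⋃ S = antisym
    (⨆-least _ _ λ i → ⨆-least _ _ λ { (z , z∈Sᵢ) → ⨆-ub proj₁ (z , i , z∈Sᵢ) })
    (⨆-least _ _ λ { (z , i , z∈Sᵢ) → ≤-trans (⨆-ub proj₁ (z , z∈Sᵢ)) (⨆-ub _ i) })

module _ {ℓ} (𝔎 : IDA ℓ) (TK : Pred (IDA.Carrier 𝔎) ℓ) where
  open IDA 𝔎
  open Joins 𝔎

  JoinOfSubset : Pred Carrier (suc ℓ)
  JoinOfSubset k = Σ (Pred Carrier ℓ) λ S → S ⊆ TK × k ≡ ⨆ₛ S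

  joinOfSubset-base : ∀ {t} → TK t → JoinOfSubset t
  joinOfSubset-base {t} t∈TK = (_≡ t) , (λ { refl → t∈TK }) , ⨆ₛ-singleton t

  joinOfSubset-⊙ : (∀ {x y} → TK x → TK y → TK (x ⊙ y)) →
                   ∀ {x y} → JoinOfSubset x → JoinOfSubset y → JoinOfSubset (x ⊙ y)
  joinOfSubset-⊙ ⊙-closed (S , S⊆TK , refl) (T , T⊆TK , refl) =
    S ⊙ₛ T , Image⊆ (λ ((s , s∈S) , (t , t∈T)) → ⊙-closed (S⊆TK s∈S) (T⊆TK t∈T)) , ⨆ₛ-⊙ S T

  joinOfSubset-* : (∀ {x} → TK x → TK (x *)) →
                   ∀ {x} → JoinOfSubset x → JoinOfSubset (x *)
  joinOfSubset-* *-closed (S , S⊆TK , refl) =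
    S *ₛ , Image⊆ (λ (s , s∈S) → *-closed (S⊆TK s∈S)) , ⨆ₛ-* S

  joinOfSubset-⨆ : ∀ {I : Set ℓ} (f : I → Carrier) →
                   (∀ i → JoinOfSubset (f i)) → JoinOfSubset (⨆ f)
  joinOfSubset-⨆ {I} f rep =
    ⋃ I S , (λ (i , z∈Sᵢ) → proj₁ (proj₂ (rep i)) z∈Sᵢ) ,
    trans (⨆-cong (λ i → proj₂ (proj₂ (rep i)))) (⨆-⨆ₛ≡⨆ₛ-⋃ S)
    where
    S : I → Pred Carrier ℓ
    S i = proj₁ (rep i)

  joinOfSubset-all : T1 𝔎 TK → TODA2 𝔎 TK → ∀ k → JoinOfSubset k
  joinOfSubset-all t1 toda2 = toda2 JoinOfSubset joinOfSubset-base
    (joinOfSubset-⊙ (T1.⊙-closed t1)) (joinOfSubset-* (T1.*-closed t1)) joinOfSubset-⨆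

lemma4p3 : ∀ {ℓ} (𝔎 : IDA ℓ) (TK : Pred (IDA.Carrier 𝔎) ℓ) →
           T1 𝔎 TK → TODA1 𝔎 → TODA2 𝔎 TK → TODA3 𝔎 TK → TODA4 𝔎 TK →
           ∀ (k : IDA.Carrier 𝔎) →
           Σ (Pred (IDA.Carrier 𝔎) ℓ) λ S →
             (S ⊆ TK) × (k ≡ IDA.⨆ₛ 𝔎 S) ×
             (∀ (S′ : Pred (IDA.Carrier 𝔎) ℓ) → S′ ⊆ TK → k ≡ IDA.⨆ₛ 𝔎 S′ → S′ ≐ S)
lemma4p3 𝔎 TK t1 _ toda2 toda3 _ k
  with S , S⊆TK , k≡⨆S ← joinOfSubset-all 𝔎 TK t1 toda2 k =
  S , S⊆TK , k≡⨆S ,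
  λ S′ S′⊆TK k≡⨆S′ → proj₁ (toda3 S′ S S′⊆TK S⊆TK) (trans (sym k≡⨆S′) k≡⨆S)
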